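{- If $G$ is an $8$-minimal graph with maximum degree at most $3$, then $G$ has girth greater than $3$.
   Context: All graphs are finite and simple. The square $G^2$ of $G$ has vertex set $V(G)$, with two vertices adjacent if their distance in $G$ is at most $2$. A graph is $k$-choosable if it admits a proper coloring from any assignment of lists of size $k$. A graph $G$ is $k$-minimal if $G^2$ is not $k$-choosable but $H^2$ is $k$-choosable for every proper subgraph $H$ of $G$. -}

module Defs where

open import Data.Nat using (ℕ; zero; suc; _+_; _≤_)
open import Data.Bool using (Bool; true; false; if_then_else_)
open import Data.Fin using (Fin)
open import Data.List using (List; length; map; allFin)
open import Data.Nat.ListAction using (sum)
open import Data.List.Membership.Propositional using (_∈_)
open import Data.List.Relation.Unary.Unique.Propositional using (Unique)
open import Data.Product using (Σ; ∃; _×_)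
open import Data.Sum using (_⊎_)
open import Data.Empty using (⊥)
open import Relation.Nullary using (¬_)
open import Relation.Binary.PropositionalEquality using (_≡_; _≢_)
open import Function.Definitions using (Injective)

record Graph (n : ℕ) : Set where
  field
    adj    : Fin n → Fin n → Bool
    sym    : ∀ u v → adj u v ≡ adj v u
    irrefl : ∀ v → adj v v ≡ false
open Graph public

Edge : ∀ {n} → Graph n → Fin n → Fin n → Set
Edge G u v = adj G u v ≡ true

degree : ∀ {n} → Graph n → Fin n → ℕ
degree {n} G v = sum (map (λ u → if adj G v u then 1 else 0) (allFin n))

MaxDegreeAtMost : ∀ {n} → ℕ → Graph n → Set
MaxDegreeAtMost d G = ∀ v → degree G v ≤ d

SqAdj : ∀ {n} → Graph n → Fin n → Fin n → Set
SqAdj {n} G u v = u ≢ v × (Edge G u v ⊎ Σ (Fin n) (λ w → Edge G u w × Edge G w v))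

IsListAssignment : ∀ {n} → ℕ → (Fin n → List ℕ) → Set
IsListAssignment k L = ∀ v → length (L v) ≡ k × Unique (L v)

SquareChoosable : ∀ {n} → ℕ → Graph n → Set
SquareChoosable {n} k G =
  (L : Fin n → List ℕ) → IsListAssignment k L →
  Σ (Fin n → ℕ) (λ c → (∀ v → c v ∈ L v) × (∀ u v → SqAdj G u v → c u ≢ c v))

IsSubgraphVia : ∀ {m n} → Graph m → Graph n → (Fin m → Fin n) → Set
IsSubgraphVia H G f = Injective _≡_ _≡_ f × (∀ u v → Edge H u v → Edge G (f u) (f v))

IsProperVia : ∀ {m n} → Graph m → Graph n → (Fin m → Fin n) → Set
IsProperVia {m} H G f =
  ¬ ((∀ v → Σ (Fin m) (λ u → f u ≡ v)) × (∀ u v → Edge G (f u) (f v) → Edge H u v))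

Minimal : ∀ {n} → ℕ → Graph n → Set
Minimal {n} k G =
  ¬ SquareChoosable k G ×
  (∀ (m : ℕ) (H : Graph m) (f : Fin m → Fin n) →
     IsSubgraphVia H G f → IsProperVia H G f → SquareChoosable k H)

-- girth > 3, i.e. no triangle (vacuously true for acyclic graphs, girth ∞)
GirthGreaterThan3 : ∀ {n} → Graph n → Set
GirthGreaterThan3 G = ∀ u v w → Edge G u v → Edge G v w → Edge G w u → ⊥

-- A triangle uvw cannot occur in an 8-minimal graph of maximum degree 3: by minimality
-- the square of G − uv is 8-choosable, and a colouring of it from the lists can be
-- repaired on u, v, w. Every square-adjacency between vertices off the triangle uses no
-- edge at u or v, so it survives in G − uv. Each triangle vertex has at most one
-- neighbour off the triangle, hence at most 1 + 1 + 1 + 2 = 5 square-neighbours off the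
-- triangle; recolouring u, v, w greedily, they must avoid at most 5, 6 and 7 colours.

module Submission where

open import Defs
open import Data.Nat using (ℕ)
open import Data.Nat.Base using (suc; z≤n; _+_; _*_; _≤_; _<_; s≤s)
open import Data.Nat.Properties using (≤-trans; ≤-pred; <-≤-trans; +-mono-≤; *-monoˡ-≤; m≤n⇒m≤1+n)
open import Data.Nat.Instances
open import Data.Bool.Base using (Bool; true; false; not; _∧_; _∨_; if_then_else_)
open import Data.Bool.Properties using (∧-comm; ∨-comm; ∧-zeroʳ)
import Data.Bool.Properties as Bool
open import Data.Fin.Base using (Fin)
open import Data.Fin.Instances
open import Data.List.Base using (List; []; _∷_; _++_; length; map; filter; concatMap; allFin)
open import Data.List.Properties using (length-++; length-map; filter-notAll)
open import Data.List.Membership.Propositional using (_∈_; _∉_)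
open import Data.List.Membership.Propositional.Properties
  using (∈-filter⁺; ∈-filter⁻; ∈-++⁺ˡ; ∈-++⁺ʳ; ∈-map⁺; ∈-concat⁺′; ∈-allFin)
import Data.List.Relation.Unary.Any as Any
open import Data.List.Relation.Unary.Any using (here; there)
open import Data.List.Relation.Unary.All as All using (All)
open import Data.List.Relation.Unary.AllPairs using (_∷_)
open import Data.List.Relation.Unary.Unique.Propositional using (Unique)
open import Data.Nat.ListAction using (sum)
open import Data.Product using (Σ; ∃-syntax; _×_; _,_; proj₁; proj₂)
open import Data.Sum using (_⊎_; inj₁; inj₂)
open import Data.Empty using (⊥-elim)
open import Function using (id)
open import Relation.Nullary using (yes; no; does; ¬?)
open import Relation.Nullary.Decidable using (dec-true; dec-false)
open import Relation.Binary.Structures using (IsDecEquivalence)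
open import Relation.Binary.TypeClasses using (_≟_)
open import Relation.Binary.PropositionalEquality as ≡
  using (_≡_; _≢_; refl; cong; cong₂; subst; subst₂; ≢-sym)

module _ {A : Set} {{_ : IsDecEquivalence {A = A} _≡_}} where

  infixl 5 _without_

  _without_ : List A → A → List A
  xs without s = filter (λ y → ¬? (y ≟ s)) xs

  ∈-without⁺ : ∀ {xs s y} → y ∈ xs → y ≢ s → y ∈ xs without s
  ∈-without⁺ {s = s} = ∈-filter⁺ (λ y → ¬? (y ≟ s))

  ∈-without⁻ : ∀ {xs s y} → y ∈ xs without s → y ∈ xs
  ∈-without⁻ {s = s} y∈ = proj₁ (∈-filter⁻ (λ y → ¬? (y ≟ s)) y∈)

  length-without : ∀ {xs s} → s ∈ xs → length (xs without s) < length xs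
  length-without {xs} {s} s∈xs =
    filter-notAll (λ y → ¬? (y ≟ s)) xs (Any.map (λ s≡y y≢s → y≢s (≡.sym s≡y)) s∈xs)

  pigeonhole : ∀ {xs ys : List A} → Unique xs → length ys < length xs → ∃[ x ] x ∈ xs × x ∉ ys
  pigeonhole {x ∷ xs} {ys} (x≢xs ∷ xs!) ys<x∷xs with Any.any? (x ≟_) ys
  ... | no x∉ys = x , here refl , x∉ys
  ... | yes x∈ys with z , z∈xs , z∉ys-x ← pigeonhole xs! (<-≤-trans (length-without x∈ys) (≤-pred ys<x∷xs)) =
    z , there z∈xs , λ z∈ys → z∉ys-x (∈-without⁺ z∈ys (≢-sym (All.lookup x≢xs z∈xs)))

length-++-≤ : ∀ {A : Set} {xs ys : List A} {a b} → length xs ≤ a → length ys ≤ b → length (xs ++ ys) ≤ a + b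
length-++-≤ {xs = xs} xs≤a ys≤b = subst (_≤ _) (≡.sym (length-++ xs)) (+-mono-≤ xs≤a ys≤b)

length-concatMap-≤ : ∀ {A B : Set} {f : A → List B} {xs k} →
                     All (λ x → length (f x) ≤ k) xs → length (concatMap f xs) ≤ length xs * k
length-concatMap-≤ All.[] = z≤n
length-concatMap-≤ {f = f} (fx≤k All.∷ fxs≤k) = length-++-≤ {xs = f _} fx≤k (length-concatMap-≤ fxs≤k)

length-filter-≡true : ∀ {A : Set} (p : A → Bool) xs →
                      length (filter (λ x → p x Bool.≟ true) xs) ≡ sum (map (λ x → if p x then 1 else 0) xs)
length-filter-≡true p [] = refl
length-filter-≡true p (x ∷ xs) with p x
... | true = cong suc (length-filter-≡true p xs)
... | false = length-filter-≡true p xs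

module _ {n : ℕ} (G : Graph n) where

  Edge-sym : ∀ {a b} → Edge G a b → Edge G b a
  Edge-sym {a} {b} ab = ≡.trans (Graph.sym G b a) ab

  Edge⇒≢ : ∀ {a b} → Edge G a b → a ≢ b
  Edge⇒≢ {a} aa refl with () ← ≡.trans (≡.sym aa) (irrefl G a)

  SqAdj-sym : ∀ {a b} → SqAdj G a b → SqAdj G b a
  SqAdj-sym (a≢b , inj₁ ab) = ≢-sym a≢b , inj₁ (Edge-sym ab)
  SqAdj-sym (a≢b , inj₂ (m , am , mb)) = ≢-sym a≢b , inj₂ (m , Edge-sym mb , Edge-sym am)

  neighbours : Fin n → List (Fin n)
  neighbours v = filter (λ x → adj G v x Bool.≟ true) (allFin n)

  ∈-neighbours⁺ : ∀ {v x} → Edge G v x → x ∈ neighbours v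
  ∈-neighbours⁺ {v} {x} = ∈-filter⁺ (λ x → adj G v x Bool.≟ true) (∈-allFin x)

  ∈-neighbours⁻ : ∀ {v x} → x ∈ neighbours v → Edge G v x
  ∈-neighbours⁻ {v} x∈ = proj₂ (∈-filter⁻ (λ x → adj G v x Bool.≟ true) {xs = allFin n} x∈)

  length-neighbours : ∀ v → length (neighbours v) ≡ degree G v
  length-neighbours v = length-filter-≡true (adj G v) (allFin n)

  otherNeighbours : Fin n → Fin n → Fin n → List (Fin n)
  otherNeighbours t p q = neighbours t without q without p

  ∈-otherNeighbours⁺ : ∀ {t p q x} → Edge G t x → x ≢ p → x ≢ q → x ∈ otherNeighbours t p q
  ∈-otherNeighbours⁺ tx x≢p x≢q = ∈-without⁺ (∈-without⁺ (∈-neighbours⁺ tx) x≢q) x≢p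

  ∈-otherNeighbours⁻ : ∀ {t p q x} → x ∈ otherNeighbours t p q → Edge G t x
  ∈-otherNeighbours⁻ x∈ = ∈-neighbours⁻ (∈-without⁻ (∈-without⁻ x∈))

  outerSquareNeighbours : Fin n → Fin n → Fin n → List (Fin n)
  outerSquareNeighbours t p q =
    otherNeighbours t p q ++ otherNeighbours p t q ++ otherNeighbours q t p ++
    concatMap (λ x → neighbours x without t) (otherNeighbours t p q)

  ∈-outerSquareNeighbours : ∀ {t p q a} → a ≢ t → a ≢ p → a ≢ q → SqAdj G t a →
                            a ∈ outerSquareNeighbours t p q
  ∈-outerSquareNeighbours a≢t a≢p a≢q (_ , inj₁ ta) = ∈-++⁺ˡ (∈-otherNeighbours⁺ ta a≢p a≢q)
  ∈-outerSquareNeighbours {t} {p} {q} a≢t a≢p a≢q (_ , inj₂ (m , tm , ma)) with m ≟ p | m ≟ q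
  ... | yes refl | _ =
    ∈-++⁺ʳ (otherNeighbours t p q) (∈-++⁺ˡ (∈-otherNeighbours⁺ ma a≢t a≢q))
  ... | no _ | yes refl =
    ∈-++⁺ʳ (otherNeighbours t p q) (∈-++⁺ʳ (otherNeighbours p t q) (∈-++⁺ˡ (∈-otherNeighbours⁺ ma a≢t a≢p)))
  ... | no m≢p | no m≢q =
    ∈-++⁺ʳ (otherNeighbours t p q) (∈-++⁺ʳ (otherNeighbours p t q) (∈-++⁺ʳ (otherNeighbours q t p)
      (∈-concat⁺′ (∈-without⁺ (∈-neighbours⁺ ma) a≢t)
                  (∈-map⁺ (λ x → neighbours x without t) (∈-otherNeighbours⁺ tm m≢p m≢q)))))

module _ {n : ℕ} (G : Graph n) (Δ≤3 : MaxDegreeAtMost 3 G) where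

  length-neighbours≤3 : ∀ x → length (neighbours G x) ≤ 3
  length-neighbours≤3 x = subst (_≤ 3) (≡.sym (length-neighbours G x)) (Δ≤3 x)

  length-neighbours-without : ∀ {x t} → Edge G x t → length (neighbours G x without t) ≤ 2
  length-neighbours-without {x} xt =
    ≤-pred (≤-trans (length-without (∈-neighbours⁺ G xt)) (length-neighbours≤3 x))

  length-otherNeighbours : ∀ {t p q} → Edge G t p → Edge G t q → p ≢ q →
                           length (otherNeighbours G t p q) ≤ 1
  length-otherNeighbours {t} tp tq p≢q =
    ≤-pred (≤-pred (≤-trans (s≤s (length-without (∈-without⁺ (∈-neighbours⁺ G tp) p≢q)))
                            (≤-trans (length-without (∈-neighbours⁺ G tq)) (length-neighbours≤3 t))))

  length-outerSquareNeighbours : ∀ {t p q} → Edge G t p → Edge G t q → Edge G p q →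
                                 length (outerSquareNeighbours G t p q) ≤ 5
  length-outerSquareNeighbours {t} {p} {q} tp tq pq =
    length-++-≤ {xs = otherNeighbours G t p q} (length-otherNeighbours tp tq (Edge⇒≢ G pq))
      (length-++-≤ {xs = otherNeighbours G p t q} (length-otherNeighbours (Edge-sym G tp) pq (Edge⇒≢ G tq))
        (length-++-≤ {xs = otherNeighbours G q t p}
          (length-otherNeighbours (Edge-sym G tq) (Edge-sym G pq) (Edge⇒≢ G tp))
          (≤-trans (length-concatMap-≤ (All.tabulate λ x∈ →
                      length-neighbours-without (Edge-sym G (∈-otherNeighbours⁻ G x∈))))
                   (*-monoˡ-≤ 2 (length-otherNeighbours tp tq (Edge⇒≢ G pq))))))

module _ {n : ℕ} where

  sameEndpoints : Fin n → Fin n → Fin n → Fin n → Bool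
  sameEndpoints u v x y = (does (x ≟ u) ∧ does (y ≟ v)) ∨ (does (x ≟ v) ∧ does (y ≟ u))

  sameEndpoints-sym : ∀ u v x y → sameEndpoints u v x y ≡ sameEndpoints u v y x
  sameEndpoints-sym u v x y =
    ≡.trans (∨-comm (does (x ≟ u) ∧ does (y ≟ v)) _)
            (cong₂ _∨_ (∧-comm (does (x ≟ v)) _) (∧-comm (does (x ≟ u)) _))

  deleteEdge : Graph n → Fin n → Fin n → Graph n
  deleteEdge G u v = record
    { adj    = λ x y → adj G x y ∧ not (sameEndpoints u v x y)
    ; sym    = λ x y → cong₂ (λ e d → e ∧ not d) (Graph.sym G x y) (sameEndpoints-sym u v x y)
    ; irrefl = λ x → cong (λ e → e ∧ not (sameEndpoints u v x x)) (irrefl G x)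
    }

  module _ (G : Graph n) (u v : Fin n) where

    Edge-deleteEdge⁻ : ∀ {x y} → Edge (deleteEdge G u v) x y → Edge G x y
    Edge-deleteEdge⁻ {x} {y} e with adj G x y
    ... | true = refl

    Edge-deleteEdge⁺ : ∀ {x y} → x ≢ u → x ≢ v → Edge G x y → Edge (deleteEdge G u v) x y
    Edge-deleteEdge⁺ {x} x≢u x≢v xy
      rewrite dec-false (x ≟ u) x≢u | dec-false (x ≟ v) x≢v | xy = refl

    adj-deleteEdge : adj (deleteEdge G u v) u v ≡ false
    adj-deleteEdge rewrite dec-true (u ≟ u) refl | dec-true (v ≟ v) refl = ∧-zeroʳ (adj G u v)

    deleteEdge-subgraph : IsSubgraphVia (deleteEdge G u v) G id
    deleteEdge-subgraph = id , λ _ _ → Edge-deleteEdge⁻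

    deleteEdge-proper : Edge G u v → IsProperVia (deleteEdge G u v) G id
    deleteEdge-proper uv (_ , edges) with () ← ≡.trans (≡.sym (edges u v uv)) adj-deleteEdge

    SqAdj-deleteEdge⁺ : ∀ {a b} → a ≢ u → a ≢ v → b ≢ u → b ≢ v → SqAdj G a b → SqAdj (deleteEdge G u v) a b
    SqAdj-deleteEdge⁺ a≢u a≢v _ _ (a≢b , inj₁ ab) = a≢b , inj₁ (Edge-deleteEdge⁺ a≢u a≢v ab)
    SqAdj-deleteEdge⁺ a≢u a≢v b≢u b≢v (a≢b , inj₂ (m , am , mb)) =
      a≢b , inj₂ (m , Edge-deleteEdge⁺ a≢u a≢v am
                    , Edge-sym (deleteEdge G u v) (Edge-deleteEdge⁺ b≢u b≢v (Edge-sym G mb)))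

module _ {n : ℕ} where

  ProperOn : Graph n → (Fin n → ℕ) → (Fin n → Set) → Set
  ProperOn G c P = ∀ a b → P a → P b → SqAdj G a b → c a ≢ c b

  recolour : (Fin n → ℕ) → Fin n → ℕ → Fin n → ℕ
  recolour c t κ x = if does (x ≟ t) then κ else c x

  module _ (G : Graph n) (L : Fin n → List ℕ) where

    recolour-proper : ∀ {P c t F κ} → (∀ x → c x ∈ L x) → ProperOn G c P →
                      (∀ a → P a → SqAdj G t a → a ∈ F) → κ ∈ L t → κ ∉ map c F →
                      (∀ x → recolour c t κ x ∈ L x) × ProperOn G (recolour c t κ) (λ x → x ≡ t ⊎ P x)
    recolour-proper {P} {c} {t} {F} {κ} c∈L c-proper covers κ∈Lt κ∉cF = c'∈L , c'-proper
      where
      c' : Fin n → ℕ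
      c' = recolour c t κ

      c'∈L : ∀ x → c' x ∈ L x
      c'∈L x with x ≟ t
      ... | yes refl = κ∈Lt
      ... | no _ = c∈L x

      κ≢c : ∀ {b} → P b → SqAdj G t b → κ ≢ c b
      κ≢c {b} Pb tb κ≡cb = κ∉cF (subst (_∈ map c F) (≡.sym κ≡cb) (∈-map⁺ c (covers b Pb tb)))

      P-of : ∀ {x} → x ≡ t ⊎ P x → x ≢ t → P x
      P-of (inj₁ x≡t) x≢t = ⊥-elim (x≢t x≡t)
      P-of (inj₂ Px) _ = Px

      c'-proper : ProperOn G c' (λ x → x ≡ t ⊎ P x)
      c'-proper a b Pa Pb ab with a ≟ t | b ≟ t
      ... | yes refl | yes refl = ⊥-elim (proj₁ ab refl)
      ... | yes refl | no b≢t = κ≢c (P-of Pb b≢t) ab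
      ... | no a≢t | yes refl = ≢-sym (κ≢c (P-of Pa a≢t) (SqAdj-sym G ab))
      ... | no a≢t | no b≢t = c-proper a b (P-of Pa a≢t) (P-of Pb b≢t) ab

    extend-proper : ∀ {k P c} → IsListAssignment k L → (∀ x → c x ∈ L x) → ProperOn G c P →
                    ∀ t F → length F < k → (∀ a → P a → SqAdj G t a → a ∈ F) →
                    Σ (Fin n → ℕ) λ c' → (∀ x → c' x ∈ L x) × ProperOn G c' (λ x → x ≡ t ⊎ P x)
    extend-proper {c = c} L-lists c∈L c-proper t F F<k covers
      with κ , κ∈Lt , κ∉cF ← pigeonhole (proj₂ (L-lists t))
                                  (subst₂ _<_ (≡.sym (length-map c F)) (≡.sym (proj₁ (L-lists t))) F<k)
      = recolour c t κ , recolour-proper c∈L c-proper covers κ∈Lt κ∉cF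

module _ {n : ℕ} (G : Graph n) (Δ≤3 : MaxDegreeAtMost 3 G) {u v w : Fin n}
         (uv : Edge G u v) (vw : Edge G v w) (wu : Edge G w u) where

  private
    Outside : Fin n → Set
    Outside x = x ≢ u × x ≢ v × x ≢ w

    outside-proper : ∀ {c} → (∀ a b → SqAdj (deleteEdge G u v) a b → c a ≢ c b) → ProperOn G c Outside
    outside-proper c-proper a b (a≢u , a≢v , _) (b≢u , b≢v , _) ab =
      c-proper a b (SqAdj-deleteEdge⁺ G u v a≢u a≢v b≢u b≢v ab)

    covers-u : ∀ a → Outside a → SqAdj G u a → a ∈ outerSquareNeighbours G u v w
    covers-u a (a≢u , a≢v , a≢w) = ∈-outerSquareNeighbours G a≢u a≢v a≢w

    covers-v : ∀ a → a ≡ u ⊎ Outside a → SqAdj G v a → a ∈ u ∷ outerSquareNeighbours G v u w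
    covers-v a (inj₁ refl) _ = here refl
    covers-v a (inj₂ (a≢u , a≢v , a≢w)) va = there (∈-outerSquareNeighbours G a≢v a≢u a≢w va)

    covers-w : ∀ a → a ≡ v ⊎ a ≡ u ⊎ Outside a → SqAdj G w a → a ∈ u ∷ v ∷ outerSquareNeighbours G w u v
    covers-w a (inj₁ refl) _ = there (here refl)
    covers-w a (inj₂ (inj₁ refl)) _ = here refl
    covers-w a (inj₂ (inj₂ (a≢u , a≢v , a≢w))) wa = there (there (∈-outerSquareNeighbours G a≢w a≢u a≢v wa))

    everywhere : ∀ x → x ≡ w ⊎ x ≡ v ⊎ x ≡ u ⊎ Outside x
    everywhere x with x ≟ w | x ≟ v | x ≟ u
    ... | yes x≡w | _ | _ = inj₁ x≡w
    ... | no _ | yes x≡v | _ = inj₂ (inj₁ x≡v)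
    ... | no _ | no _ | yes x≡u = inj₂ (inj₂ (inj₁ x≡u))
    ... | no x≢w | no x≢v | no x≢u = inj₂ (inj₂ (inj₂ (x≢u , x≢v , x≢w)))

  triangle-reducible : SquareChoosable 8 (deleteEdge G u v) → SquareChoosable 8 G
  triangle-reducible χ L L-lists =
    let c₀ , c₀∈L , c₀-proper = χ L L-lists
        c₁ , c₁∈L , c₁-proper = extend-proper G L L-lists c₀∈L (outside-proper c₀-proper)
                                  u _ (s≤s (m≤n⇒m≤1+n (m≤n⇒m≤1+n ℓu))) covers-u
        c₂ , c₂∈L , c₂-proper = extend-proper G L L-lists c₁∈L c₁-proper
                                  v _ (s≤s (s≤s (m≤n⇒m≤1+n ℓv))) covers-v
        c₃ , c₃∈L , c₃-proper = extend-proper G L L-lists c₂∈L c₂-proper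
                                  w _ (s≤s (s≤s (s≤s ℓw))) covers-w
    in c₃ , c₃∈L , λ a b → c₃-proper a b (everywhere a) (everywhere b)
    where
    ℓu : length (outerSquareNeighbours G u v w) ≤ 5
    ℓu = length-outerSquareNeighbours G Δ≤3 uv (Edge-sym G wu) vw
    ℓv : length (outerSquareNeighbours G v u w) ≤ 5
    ℓv = length-outerSquareNeighbours G Δ≤3 (Edge-sym G uv) vw (Edge-sym G wu)
    ℓw : length (outerSquareNeighbours G w u v) ≤ 5
    ℓw = length-outerSquareNeighbours G Δ≤3 wu (Edge-sym G vw) uv

lemma6 : ∀ {n : ℕ} (G : Graph n) → Minimal 8 G → MaxDegreeAtMost 3 G → GirthGreaterThan3 G
lemma6 G (¬χ , minimal) Δ≤3 u v w uv vw wu =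
  ¬χ (triangle-reducible G Δ≤3 uv vw wu
        (minimal _ (deleteEdge G u v) id (deleteEdge-subgraph G u v) (deleteEdge-proper G u v uv)))
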